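{- Let $n,k$ be positive integers with $n\ge 2k$ and $\gcd(n,k)=1$. Then $\alpha(Q(n,k))=k$, and for every independent set of $Q(n,k)$ with $k$ elements there is an element $i\in[n]$ contained in all the $k$-subsets forming it.
   Context: For a positive integer $n$ let $[n]=\{1,\dots,n\}$ and let $C_n$ be the cycle on $[n]$ with edges $\{i,i+1\}$ ($1\le i\le n-1$) and $\{n,1\}$. The Schrijver graph $\mathrm{SG}(n,k)$ ($n\ge 2k$) has as vertices the $k$-subsets of $[n]$ containing no two cyclically consecutive elements, two vertices adjacent iff they are disjoint. An arc of $C_n$ is a set $\{i,i+1,\dots,i+m-1\}$ (addition mod $n$) with $1\le m\le n-1$. A set $U\subseteq[n]$ is well-spread if for any two arcs $A,B$ with $|A|=|B|$ we have $\big||A\cap U|-|B\cap U|\big|\le 1$. $Q(n,k)$ is the induced subgraph of $\mathrm{SG}(n,k)$ on all well-spread $k$-subsets of $[n]$. $\alpha$ denotes the independence number. -}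

module Defs where

open import Data.Nat using (ℕ; zero; suc; _+_; _%_; _≤_; ∣_-_∣)
open import Data.Nat.DivMod using (m%n<n)
open import Data.Fin using (Fin; toℕ; fromℕ<)
open import Data.Fin.Subset using (Subset; _∈_; _∉_; ∣_∣)
open import Data.Bool using (true; false)
open import Data.Vec using (lookup)
open import Data.Product using (_×_; ∃)
open import Data.List using (List)
open import Data.List.Relation.Unary.Unique.Propositional using (Unique)
open import Data.List.Relation.Unary.AllPairs using (AllPairs)
open import Data.List.Relation.Unary.All using (All)
open import Relation.Nullary using (¬_)
open import Relation.Binary.PropositionalEquality using (_≡_)

-- Ground set [n] is modelled by Fin n: the element i ∈ Fin n stands for i+1 ∈ [n].
-- A subset of [n] is a Data.Fin.Subset n (a Vec of inside/outside flags).

csuc : {n : ℕ} → Fin n → Fin n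
csuc {suc n} i = fromℕ< (m%n<n (suc (toℕ i)) (suc n))

Stable : {n : ℕ} → Subset n → Set
Stable {n} S = (i : Fin n) → i ∈ S → csuc i ∉ S

arcCount : {n : ℕ} → Subset n → Fin n → ℕ → ℕ
arcCount U i zero = 0
arcCount U i (suc m) with lookup U i
... | true  = suc (arcCount U (csuc i) m)
... | false = arcCount U (csuc i) m

WellSpread : {n : ℕ} → Subset n → Set
WellSpread {n} U = (m : ℕ) → 1 ≤ m → suc m ≤ n →
  (a b : Fin n) → ∣ arcCount U a m - arcCount U b m ∣ ≤ 1

QVertex : (n k : ℕ) → Subset n → Set
QVertex n k S = (∣ S ∣ ≡ k) × Stable S × WellSpread S

-- adjacency in SG(n,k) (hence in the induced subgraph Q(n,k)): disjointness
Disjoint : {n : ℕ} → Subset n → Subset n → Set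
Disjoint {n} S T = (i : Fin n) → i ∈ S → i ∉ T

IndependentQ : (n k : ℕ) → List (Subset n) → Set
IndependentQ n k I =
  Unique I × All (QVertex n k) I × AllPairs (λ S T → ¬ Disjoint S T) I

{-# OPTIONS --safe #-}
module Submission where

-- Write N = n and e = N - k. For c ∈ ℕ the set {i : (c + i e) mod N < k} has k elements, no two of
-- them consecutive (consecutive phases differ by e ≥ k), and is well spread: an arc of length m
-- meets it in (m k + r' - r) / N points, where r, r' ∈ [0,N) are the phases at its two ends.
-- Conversely every well-spread k-set has this form: for the minimiser j₀ of |U ∩ [0,j)| N - j k,
-- every arc starting at j₀ carries at least its share m k / N, which pins down the phase of each
-- point. So an independent set of Q(N,k) is a family of phases whose k-arcs [-c, -c + k) of ℤ_N
-- pairwise meet. Katona's circle argument bounds such a family by k, and for N > 2k, which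
-- coprimality forces unless k = 1, a family of size k has a common point. As gcd(N,k) = 1 makes
-- i ↦ i e mod N onto ℤ_N, that point comes from an element of [n] lying in every member.

open import Defs
open import Data.Nat
open import Data.Nat.Properties
open import Data.Nat.DivMod
open import Data.Nat.GCD using (gcd; gcd-GCD; gcd-greatest; module Bézout)
open import Data.Nat.Divisibility using (_∣_; ∣-refl; ∣m∣n⇒∣m+n; ∣1⇒≡1)
open import Data.Nat.Tactic.RingSolver using (solve-∀)
open import Data.Bool using (Bool; true; false; if_then_else_) renaming (_≟_ to _≟ᵇ_)
open import Data.Fin using (Fin; toℕ; fromℕ<; punchOut) renaming (zero to fzero; suc to fsuc)
open import Data.Fin.Properties using (toℕ-injective; toℕ<n; toℕ-fromℕ<; any?; all?; punchOut-injective; injective⇒≤)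
  renaming (_≟_ to _≟ᶠ_)
open import Data.Fin.Subset using (Subset; _∈_; ∣_∣; inside)
open import Data.Fin.Subset.Properties using (_∈?_)
open import Data.Vec using (Vec; []; _∷_; lookup; tabulate; count)
open import Data.Vec.Properties using (lookup∘tabulate; []=⇒lookup; lookup⇒[]=; tabulate∘lookup; tabulate-cong)
open import Data.List as List using (List; length; applyUpTo)
open import Data.List.Properties using (length-applyUpTo)
open import Data.List.Membership.Propositional using () renaming (_∈_ to _∈ₗ_)
open import Data.List.Membership.Propositional.Properties using (∈-lookup)
import Data.List.Relation.Unary.Any as Any
open import Data.List.Relation.Unary.Any.Properties using (lookup-index)
open import Data.List.Relation.Unary.All as All using (All)
open import Data.List.Relation.Unary.AllPairs using (AllPairs; _∷_)
import Data.List.Relation.Unary.All.Properties as All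
import Data.List.Relation.Unary.AllPairs.Properties as AllPairs
open import Data.List.Relation.Unary.Unique.Propositional using (Unique)
import Data.List.Relation.Unary.Unique.Propositional.Properties as Unique
open import Data.Product using (∃; _×_; _,_; proj₁; proj₂)
open import Data.Sum using (_⊎_; inj₁; inj₂; [_,_]′)
open import Data.Empty using (⊥; ⊥-elim)
open import Function.Definitions using (Injective)
open import Relation.Nullary using (¬_; ¬?; Dec; yes; no; does; _×-dec_; _→-dec_)
open import Relation.Nullary.Decidable using (dec-true; dec-false; decidable-stable)
open import Relation.Binary.PropositionalEquality
  using (_≡_; _≢_; refl; sym; trans; cong; cong₂; subst; subst₂; module ≡-Reasoning)

bit : Bool → ℕ
bit true  = 1
bit false = 0

m≤1+n⇒∣m-n∣≤1 : ∀ m n → m ≤ suc n → n ≤ suc m → ∣ m - n ∣ ≤ 1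
m≤1+n⇒∣m-n∣≤1 zero          zero          _       _       = z≤n
m≤1+n⇒∣m-n∣≤1 zero          (suc zero)    _       _       = s≤s z≤n
m≤1+n⇒∣m-n∣≤1 zero          (suc (suc n)) _       (s≤s ())
m≤1+n⇒∣m-n∣≤1 (suc zero)    zero          _       _       = s≤s z≤n
m≤1+n⇒∣m-n∣≤1 (suc (suc m)) zero          (s≤s ()) _
m≤1+n⇒∣m-n∣≤1 (suc m)       (suc n)       (s≤s p) (s≤s q) = m≤1+n⇒∣m-n∣≤1 m n p q

∣m-n∣≤1⇒m≤1+n : ∀ m n → ∣ m - n ∣ ≤ 1 → m ≤ suc n
∣m-n∣≤1⇒m≤1+n zero          n       _       = z≤n
∣m-n∣≤1⇒m≤1+n (suc zero)    zero    _       = s≤s z≤n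
∣m-n∣≤1⇒m≤1+n (suc (suc m)) zero    (s≤s ())
∣m-n∣≤1⇒m≤1+n (suc m)       (suc n) p       = s≤s (∣m-n∣≤1⇒m≤1+n m n p)

argmin : ∀ (F : ℕ → ℕ) n → ∃ λ j → j < suc n × (∀ j' → j' < suc n → F j ≤ F j')
argmin F zero = 0 , s≤s z≤n , λ { zero _ → ≤-refl ; (suc j') (s≤s ()) }
argmin F (suc n) with argmin F n
... | j , j<1+n , minimal with F j ≤? F (suc n)
...   | yes Fj≤ = j , m≤n⇒m≤1+n j<1+n , λ j' j'<2+n → minimal′ j' j'<2+n
  where
  minimal′ : ∀ j' → j' < suc (suc n) → F j ≤ F j'
  minimal′ j' (s≤s j'≤1+n) with m≤n⇒m<n∨m≡n j'≤1+n
  ... | inj₁ j'<1+n = minimal j' j'<1+n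
  ... | inj₂ refl   = Fj≤
...   | no Fj≰ = suc n , ≤-refl , λ j' j'<2+n → minimal′ j' j'<2+n
  where
  minimal′ : ∀ j' → j' < suc (suc n) → F (suc n) ≤ F j'
  minimal′ j' (s≤s j'≤1+n) with m≤n⇒m<n∨m≡n j'≤1+n
  ... | inj₁ j'<1+n = ≤-trans (<⇒≤ (≰⇒> Fj≰)) (minimal j' j'<1+n)
  ... | inj₂ refl   = ≤-refl

injective⇒surjective : ∀ {m n} (f : Fin m → Fin n) → Injective _≡_ _≡_ f → n ≤ m →
                       ∀ v → ∃ λ j → f j ≡ v
injective⇒surjective {m} {suc n} f f-inj n≤m v with any? (λ j → f j ≟ᶠ v)
... | yes hit = hit
... | no miss = ⊥-elim (<⇒≱ (s≤s (injective⇒≤ {f = f′} f′-inj)) n≤m)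
  where
  v≢f : ∀ j → v ≢ f j
  v≢f j eq = miss (j , sym eq)
  f′ : Fin m → Fin n
  f′ j = punchOut (v≢f j)
  f′-inj : Injective _≡_ _≡_ f′
  f′-inj {a} {b} eq = f-inj (punchOut-injective (v≢f a) (v≢f b) eq)

AllPairs-lookup : ∀ {A : Set} {R : A → A → Set} {xs : List A} → (∀ {a b} → R a b → R b a) →
                  AllPairs R xs → ∀ i j → i ≢ j → R (List.lookup xs i) (List.lookup xs j)
AllPairs-lookup sym-R (r ∷ rs) fzero    fzero    i≢j = ⊥-elim (i≢j refl)
AllPairs-lookup sym-R (r ∷ rs) fzero    (fsuc j) i≢j = All.lookup r (∈-lookup j)
AllPairs-lookup sym-R (r ∷ rs) (fsuc i) fzero    i≢j = sym-R (All.lookup r (∈-lookup i))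
AllPairs-lookup sym-R (r ∷ rs) (fsuc i) (fsuc j) i≢j = AllPairs-lookup sym-R rs i j (λ i≡j → i≢j (cong fsuc i≡j))

Unique-lookup-injective : ∀ {A : Set} {xs : List A} → Unique xs → Injective _≡_ _≡_ (List.lookup xs)
Unique-lookup-injective u {i} {j} eq with i ≟ᶠ j
... | yes i≡j = i≡j
... | no  i≢j = ⊥-elim (AllPairs-lookup (λ x≢y y≡x → x≢y (sym y≡x)) u i j i≢j eq)

threshold : ∀ (Q : ℕ → Set) → (∀ v → Dec (Q v)) → ∀ n → (∀ v → Q v → suc v < n → Q (suc v)) →
            ∀ m → m ≤ n → ∃ λ J → J ≤ m × (∀ v → v < J → ¬ Q v) × (∀ v → J ≤ v → v < m → Q v)
threshold Q Q? n up zero    _     = 0 , z≤n , (λ _ ()) , (λ _ _ ())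
threshold Q Q? n up (suc m) 1+m≤n with threshold Q Q? n up m (<⇒≤ 1+m≤n) | Q? m
... | J , J≤m , below , above | yes Qm = J , m≤n⇒m≤1+n J≤m , below , above′
  where
  above′ : ∀ v → J ≤ v → v < suc m → Q v
  above′ v J≤v (s≤s v≤m) with m≤n⇒m<n∨m≡n v≤m
  ... | inj₁ v<m = above v J≤v v<m
  ... | inj₂ refl = Qm
... | J , J≤m , below , above | no ¬Qm with m≤n⇒m<n∨m≡n J≤m
...   | inj₁ J<m  = ⊥-elim (¬Qm (Q-next J m J<m 1+m≤n above))
  where
  Q-next : ∀ J m → J < m → m < n → (∀ v → J ≤ v → v < m → Q v) → Q m
  Q-next J (suc m) (s≤s J≤m) 1+m<n above = up m (above m J≤m ≤-refl) 1+m<n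
...   | inj₂ refl = suc J , ≤-refl , below′ , λ v 1+J≤v v<1+J → ⊥-elim (<⇒≱ v<1+J 1+J≤v)
  where
  below′ : ∀ v → v < suc J → ¬ Q v
  below′ v (s≤s v≤J) with m≤n⇒m<n∨m≡n v≤J
  ... | inj₁ v<J = below v v<J
  ... | inj₂ refl = ¬Qm

quotient-≤-suc : ∀ N A B x x' y y' M → A * N + x ≡ x' + M → B * N + y ≡ y' + M → x' < N → y < N → A ≤ suc B
quotient-≤-suc N A B x x' y y' M eqA eqB x'<N y<N with suc (suc B) ≤? A
... | no  A≱2+B = ≤-pred (≰⇒> A≱2+B)
... | yes 2+B≤A = ⊥-elim (<-irrefl refl (begin-strict
  N + N + M                   ≤⟨ m≤m+n (N + N + M) (y' + x) ⟩
  N + N + M + (y' + x)        ≡⟨ s₁ N M y' x ⟩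
  N + N + (y' + M) + x        ≡⟨ cong (λ z → N + N + z + x) eqB ⟨
  N + N + (B * N + y) + x     ≡⟨ s₂ N B y x ⟩
  (2 + B) * N + y + x         ≤⟨ +-monoˡ-≤ x (+-monoˡ-≤ y (*-monoˡ-≤ N 2+B≤A)) ⟩
  A * N + y + x               ≡⟨ s₃ A N y x ⟩
  (A * N + x) + y             ≡⟨ cong (_+ y) eqA ⟩
  (x' + M) + y                <⟨ +-mono-< (+-monoˡ-< M x'<N) y<N ⟩
  N + M + N                   ≡⟨ s₄ N M ⟩
  N + N + M                   ∎))
  where
  open ≤-Reasoning
  s₁ : ∀ N M y' x → N + N + M + (y' + x) ≡ N + N + (y' + M) + x
  s₁ = solve-∀
  s₂ : ∀ N B y x → N + N + (B * N + y) + x ≡ (2 + B) * N + y + x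
  s₂ = solve-∀
  s₃ : ∀ A N y x → A * N + y + x ≡ (A * N + x) + y
  s₃ = solve-∀
  s₄ : ∀ N M → N + M + N ≡ N + N + M
  s₄ = solve-∀

module Cycle (n' : ℕ) where

  N : ℕ
  N = suc n'

  shift : ℕ → Fin N → Fin N
  shift zero    i = i
  shift (suc a) i = shift a (csuc i)

  toℕ-csuc : ∀ i → toℕ (csuc i) ≡ suc (toℕ i) % N
  toℕ-csuc i = toℕ-fromℕ< (m%n<n (suc (toℕ i)) N)

  toℕ-shift : ∀ a i → toℕ (shift a i) ≡ (toℕ i + a) % N
  toℕ-shift zero    i = trans (sym (m<n⇒m%n≡m (toℕ<n i))) (cong (_% N) (sym (+-identityʳ (toℕ i))))
  toℕ-shift (suc a) i = begin
    toℕ (shift a (csuc i))                ≡⟨ toℕ-shift a (csuc i) ⟩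
    (toℕ (csuc i) + a) % N                ≡⟨ cong (λ x → (x + a) % N) (toℕ-csuc i) ⟩
    (suc (toℕ i) % N + a) % N             ≡⟨ %-distribˡ-+ (suc (toℕ i) % N) a N ⟩
    (suc (toℕ i) % N % N + a % N) % N     ≡⟨ cong (λ x → (x + a % N) % N) (m%n%n≡m%n (suc (toℕ i)) N) ⟩
    (suc (toℕ i) % N + a % N) % N         ≡⟨ %-distribˡ-+ (suc (toℕ i)) a N ⟨
    (suc (toℕ i) + a) % N                 ≡⟨ cong (_% N) (+-suc (toℕ i) a) ⟨
    (toℕ i + suc a) % N                   ∎
    where open ≡-Reasoning

  shift-N : ∀ i → shift N i ≡ i
  shift-N i = toℕ-injective (trans (toℕ-shift N i) (trans ([m+n]%n≡m%n (toℕ i) N) (m<n⇒m%n≡m (toℕ<n i))))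

  shift-from-zero : ∀ i → shift (toℕ i) fzero ≡ i
  shift-from-zero i = toℕ-injective (trans (toℕ-shift (toℕ i) fzero) (m<n⇒m%n≡m (toℕ<n i)))

  arcCount-suc : ∀ (U : Subset N) i m → arcCount U i (suc m) ≡ bit (lookup U i) + arcCount U (csuc i) m
  arcCount-suc U i m with lookup U i
  ... | true  = refl
  ... | false = refl

  arcCount-1 : ∀ (U : Subset N) i → arcCount U i 1 ≡ bit (lookup U i)
  arcCount-1 U i = trans (arcCount-suc U i 0) (+-identityʳ _)

  arcCount-+ : ∀ (U : Subset N) a b i → arcCount U i (a + b) ≡ arcCount U i a + arcCount U (shift a i) b
  arcCount-+ U zero    b i = refl
  arcCount-+ U (suc a) b i = begin
    arcCount U i (suc (a + b))                                    ≡⟨ arcCount-suc U i (a + b) ⟩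
    bit (lookup U i) + arcCount U (csuc i) (a + b)                ≡⟨ cong (bit (lookup U i) +_) (arcCount-+ U a b (csuc i)) ⟩
    bit (lookup U i) + (arcCount U (csuc i) a + arcCount U (shift a (csuc i)) b)
                                                                  ≡⟨ +-assoc (bit (lookup U i)) _ _ ⟨
    (bit (lookup U i) + arcCount U (csuc i) a) + arcCount U (shift a (csuc i)) b
                                                                  ≡⟨ cong (_+ arcCount U (shift a (csuc i)) b) (arcCount-suc U i a) ⟨
    arcCount U i (suc a) + arcCount U (shift (suc a) i) b         ∎
    where open ≡-Reasoning

  arcCount-N-csuc : ∀ (U : Subset N) i → arcCount U (csuc i) N ≡ arcCount U i N
  arcCount-N-csuc U i = +-cancelˡ-≡ (bit (lookup U i)) _ _ (begin
    bit (lookup U i) + arcCount U (csuc i) N      ≡⟨ arcCount-suc U i N ⟨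
    arcCount U i (suc N)                          ≡⟨ cong (arcCount U i) (+-comm 1 N) ⟩
    arcCount U i (N + 1)                          ≡⟨ arcCount-+ U N 1 i ⟩
    arcCount U i N + arcCount U (shift N i) 1     ≡⟨ cong (λ j → arcCount U i N + arcCount U j 1) (shift-N i) ⟩
    arcCount U i N + arcCount U i 1               ≡⟨ cong (arcCount U i N +_) (arcCount-1 U i) ⟩
    arcCount U i N + bit (lookup U i)             ≡⟨ +-comm (arcCount U i N) (bit (lookup U i)) ⟩
    bit (lookup U i) + arcCount U i N             ∎)
    where open ≡-Reasoning

  arcCount-N-shift : ∀ (U : Subset N) a i → arcCount U (shift a i) N ≡ arcCount U i N
  arcCount-N-shift U zero    i = refl
  arcCount-N-shift U (suc a) i = trans (arcCount-N-shift U a (csuc i)) (arcCount-N-csuc U i)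

  -- An arc that does not wrap around is a segment of the vector.
  lookupℕ : ∀ {m} → Vec Bool m → ℕ → Bool
  lookupℕ []      _       = false
  lookupℕ (x ∷ v) zero    = x
  lookupℕ (x ∷ v) (suc j) = lookupℕ v j

  lookup≡lookupℕ : ∀ {m} (v : Vec Bool m) i → lookup v i ≡ lookupℕ v (toℕ i)
  lookup≡lookupℕ (x ∷ v) fzero    = refl
  lookup≡lookupℕ (x ∷ v) (fsuc i) = lookup≡lookupℕ v i

  segmentCount : ∀ {m} → Vec Bool m → ℕ → ℕ → ℕ
  segmentCount v j zero    = 0
  segmentCount v j (suc t) = bit (lookupℕ v j) + segmentCount v (suc j) t

  segmentCount-∷ : ∀ {m} x (v : Vec Bool m) j t → segmentCount (x ∷ v) (suc j) t ≡ segmentCount v j t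
  segmentCount-∷ x v j zero    = refl
  segmentCount-∷ x v j (suc t) = cong (bit (lookupℕ v j) +_) (segmentCount-∷ x v (suc j) t)

  segmentCount-all : ∀ {m} (v : Vec Bool m) → segmentCount v 0 m ≡ count (_≟ᵇ inside) v
  segmentCount-all []                 = refl
  segmentCount-all {suc m} (true ∷ v)  = cong suc (trans (segmentCount-∷ true v 0 m) (segmentCount-all v))
  segmentCount-all {suc m} (false ∷ v) = trans (segmentCount-∷ false v 0 m) (segmentCount-all v)

  arcCount≡segmentCount : ∀ (U : Subset N) m i → toℕ i + m ≤ N → arcCount U i m ≡ segmentCount U (toℕ i) m
  arcCount≡segmentCount U zero          i _ = refl
  arcCount≡segmentCount U (suc zero)    i _ =
    trans (arcCount-1 U i) (trans (cong bit (lookup≡lookupℕ U i)) (sym (+-identityʳ _)))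
  arcCount≡segmentCount U (suc (suc m)) i i+m+2≤N = begin
    arcCount U i (suc (suc m))                           ≡⟨ arcCount-suc U i (suc m) ⟩
    bit (lookup U i) + arcCount U (csuc i) (suc m)       ≡⟨ cong₂ _+_ (cong bit (lookup≡lookupℕ U i))
                                                                      (arcCount≡segmentCount U (suc m) (csuc i) fits) ⟩
    bit (lookupℕ U (toℕ i)) + segmentCount U (toℕ (csuc i)) (suc m)
                                                         ≡⟨ cong (λ x → bit (lookupℕ U (toℕ i)) + segmentCount U x (suc m)) no-wrap ⟩
    bit (lookupℕ U (toℕ i)) + segmentCount U (suc (toℕ i)) (suc m) ∎
    where
    open ≡-Reasoning
    i+m+2≡ : toℕ i + suc (suc m) ≡ suc (suc (toℕ i + m))
    i+m+2≡ = trans (+-suc (toℕ i) (suc m)) (cong suc (+-suc (toℕ i) m))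
    no-wrap : toℕ (csuc i) ≡ suc (toℕ i)
    no-wrap = trans (toℕ-csuc i) (m<n⇒m%n≡m (≤-trans (s≤s (s≤s (m≤m+n (toℕ i) m))) (subst (_≤ N) i+m+2≡ i+m+2≤N)))
    fits : toℕ (csuc i) + suc m ≤ N
    fits = subst (λ x → x + suc m ≤ N) (sym no-wrap) (subst (_≤ N) (+-suc (toℕ i) (suc m)) i+m+2≤N)

  arcCount-N : ∀ (U : Subset N) i → arcCount U i N ≡ ∣ U ∣
  arcCount-N U i = begin
    arcCount U i N                      ≡⟨ cong (λ j → arcCount U j N) (shift-from-zero i) ⟨
    arcCount U (shift (toℕ i) fzero) N  ≡⟨ arcCount-N-shift U (toℕ i) fzero ⟩
    arcCount U fzero N                  ≡⟨ arcCount≡segmentCount U N fzero ≤-refl ⟩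
    segmentCount U 0 N                  ≡⟨ segmentCount-all U ⟩
    ∣ U ∣                               ∎
    where open ≡-Reasoning

  arcCount-*N : ∀ (U : Subset N) m i → arcCount U i (m * N) ≡ m * ∣ U ∣
  arcCount-*N U zero    i = refl
  arcCount-*N U (suc m) i = trans (arcCount-+ U N (m * N) i)
    (cong₂ _+_ (arcCount-N U i) (trans (cong (λ j → arcCount U j (m * N)) (shift-N i)) (arcCount-*N U m i)))

  _≋_ : ℕ → ℕ → Set
  a ≋ b = a % N ≡ b % N

  ≋-by-multiples : ∀ a b A B → a + A * N ≡ b + B * N → a ≋ b
  ≋-by-multiples a b A B eq = trans (sym ([m+kn]%n≡m%n a A N)) (trans (cong (_% N) eq) ([m+kn]%n≡m%n b B N))

  +-≋ : ∀ a a' b b' → a ≋ a' → b ≋ b' → (a + b) ≋ (a' + b')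
  +-≋ a a' b b' p q = trans (%-distribˡ-+ a b N) (trans (cong₂ (λ u v → (u + v) % N) p q) (sym (%-distribˡ-+ a' b' N)))

  ≡⇒≋ : ∀ {a b} → a ≡ b → a ≋ b
  ≡⇒≋ = cong (_% N)

  %-≋ : ∀ a → (a % N) ≋ a
  %-≋ a = m%n%n≡m%n a N

  +N-≋ : ∀ a → (a + N) ≋ a
  +N-≋ a = [m+n]%n≡m%n a N

  ≋⇒≡ : ∀ {a b} → a ≋ b → a < N → b < N → a ≡ b
  ≋⇒≡ {a} {b} p a<N b<N = trans (sym (m<n⇒m%n≡m a<N)) (trans p (m<n⇒m%n≡m b<N))

  ≋⇒+multiples : ∀ a b → a ≋ b → a + (b / N) * N ≡ b + (a / N) * N
  ≋⇒+multiples a b p = begin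
    a + (b / N) * N                        ≡⟨ cong (_+ (b / N) * N) (m≡m%n+[m/n]*n a N) ⟩
    a % N + (a / N) * N + (b / N) * N      ≡⟨ cong (λ z → z + (a / N) * N + (b / N) * N) p ⟩
    b % N + (a / N) * N + (b / N) * N      ≡⟨ swap (b % N) ((a / N) * N) ((b / N) * N) ⟩
    b % N + (b / N) * N + (a / N) * N      ≡⟨ cong (_+ (a / N) * N) (m≡m%n+[m/n]*n b N) ⟨
    b + (a / N) * N                        ∎
    where
    open ≡-Reasoning
    swap : ∀ x y z → x + y + z ≡ x + z + y
    swap = solve-∀

  ≋-cancelʳ : ∀ a b x → (a + x) ≋ (b + x) → a ≋ b
  ≋-cancelʳ a b x p = ≋-by-multiples a b ((b + x) / N) ((a + x) / N)
    (+-cancelʳ-≡ x _ _ (trans (swap a x _) (trans (≋⇒+multiples (a + x) (b + x) p) (sym (swap b x _)))))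
    where
    swap : ∀ a x y → a + y + x ≡ a + x + y
    swap = solve-∀

  gap : ℕ → ℕ → ℕ
  gap a b = (b + (N ∸ a)) % N

  gap<N : ∀ a b → gap a b < N
  gap<N a b = m%n<n (b + (N ∸ a)) N

  gap+a : ∀ a b → a ≤ N → b < N → (gap a b + a) % N ≡ b
  gap+a a b a≤N b<N = begin
    (gap a b + a) % N           ≡⟨ +-≋ (gap a b) (b + (N ∸ a)) a a (%-≋ (b + (N ∸ a))) refl ⟩
    (b + (N ∸ a) + a) % N       ≡⟨ ≡⇒≋ (trans (+-assoc b (N ∸ a) a) (cong (b +_) (m∸n+n≡m a≤N))) ⟩
    (b + N) % N                 ≡⟨ +N-≋ b ⟩
    b % N                       ≡⟨ m<n⇒m%n≡m b<N ⟩
    b                           ∎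
    where open ≡-Reasoning

  gap-injective : ∀ a b c → a ≤ N → b < N → c < N → gap a b ≡ gap a c → b ≡ c
  gap-injective a b c a≤N b<N c<N eq =
    trans (sym (gap+a a b a≤N b<N)) (trans (cong (λ z → (z + a) % N) eq) (gap+a a c a≤N c<N))

  gap-from-sum : ∀ a b c x → a ≤ N → b < N → c < N → x < N → (gap a b + x) ≋ gap a c → gap b c ≡ x
  gap-from-sum a b c x a≤N b<N c<N x<N p = ≋⇒≡ (≋-cancelʳ (gap b c) x b (trans via-c (sym via-b))) (gap<N b c) x<N
    where
    open ≡-Reasoning
    via-c : (gap b c + b) ≋ c
    via-c = trans (gap+a b c (<⇒≤ b<N) c<N) (sym (m<n⇒m%n≡m c<N))
    swap : ∀ x y a → x + (y + a) ≡ (y + x) + a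
    swap = solve-∀
    via-b : (x + b) ≋ c
    via-b = begin
      (x + b) % N                 ≡⟨ +-≋ x x b (gap a b + a) refl (sym (trans (gap+a a b a≤N b<N) (sym (m<n⇒m%n≡m b<N)))) ⟩
      (x + (gap a b + a)) % N     ≡⟨ ≡⇒≋ (swap x (gap a b) a) ⟩
      ((gap a b + x) + a) % N     ≡⟨ +-≋ (gap a b + x) (gap a c) a a p refl ⟩
      (gap a c + a) % N           ≡⟨ gap+a a c a≤N c<N ⟩
      c                           ≡⟨ m<n⇒m%n≡m c<N ⟨
      c % N                       ∎


module Phases (n' k : ℕ) (k≤N : k ≤ suc n') where

  open Cycle n' public

  e : ℕ
  e = N ∸ k

  e+k≡N : e + k ≡ N
  e+k≡N = m∸n+n≡m k≤N

  phase : ℕ → Fin N → ℕ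
  phase c i = (c + toℕ i * e) % N

  phase<N : ∀ c i → phase c i < N
  phase<N c i = m%n<n (c + toℕ i * e) N

  phase-csuc : ∀ c i → phase c (csuc i) ≡ (phase c i + e) % N
  phase-csuc c i = ≋-by-multiples (c + toℕ (csuc i) * e) (phase c i + e) (q * e) p (begin
    c + t' * e + q * e * N     ≡⟨ s₁ c t' q e N ⟩
    c + (t' + q * N) * e       ≡⟨ cong (λ x → c + x * e) t+1≡ ⟨
    c + suc t * e              ≡⟨ s₂ c t e ⟩
    (c + t * e) + e            ≡⟨ cong (_+ e) (m≡m%n+[m/n]*n (c + t * e) N) ⟩
    (phase c i + p * N) + e    ≡⟨ s₃ (phase c i) p N e ⟩
    phase c i + e + p * N      ∎)
    where
    open ≡-Reasoning
    t = toℕ i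
    t' = toℕ (csuc i)
    q = suc t / N
    p = (c + t * e) / N
    t+1≡ : suc t ≡ t' + q * N
    t+1≡ = trans (m≡m%n+[m/n]*n (suc t) N) (cong (_+ q * N) (sym (toℕ-csuc i)))
    s₁ : ∀ c t q e N → c + t * e + q * e * N ≡ c + (t + q * N) * e
    s₁ = solve-∀
    s₂ : ∀ c t e → c + (1 + t) * e ≡ (c + t * e) + e
    s₂ = solve-∀
    s₃ : ∀ r p N e → (r + p * N) + e ≡ r + e + p * N
    s₃ = solve-∀

  -- One step along the cycle: the phase grows by e and drops by N exactly at the elements of the set.
  phase-step : ∀ x → x < N → bit (does (x <? k)) * N + x ≡ (x + e) % N + k
  phase-step x x<N with x <? k
  ... | yes x<k rewrite dec-true (x <? k) x<k = begin
    N + 0 + x           ≡⟨ cong (_+ x) (+-identityʳ N) ⟩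
    N + x               ≡⟨ cong (_+ x) e+k≡N ⟨
    e + k + x           ≡⟨ s e k x ⟩
    (x + e) + k         ≡⟨ cong (_+ k) (m<n⇒m%n≡m x+e<N) ⟨
    (x + e) % N + k     ∎
    where
    open ≡-Reasoning
    s : ∀ e k x → e + k + x ≡ (x + e) + k
    s = solve-∀
    x+e<N : x + e < N
    x+e<N = subst (x + e <_) (trans (+-comm k e) e+k≡N) (+-monoˡ-< e x<k)
  ... | no x≮k rewrite dec-false (x <? k) x≮k = begin
    x                        ≡⟨ m∸n+n≡m k≤x ⟨
    (x ∸ k) + k              ≡⟨ cong (_+ k) (m<n⇒m%n≡m (≤-<-trans (m∸n≤m x k) x<N)) ⟨
    (x ∸ k) % N + k          ≡⟨ cong (_+ k) (+N-≋ (x ∸ k)) ⟨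
    ((x ∸ k) + N) % N + k    ≡⟨ cong (λ y → y % N + k) x-k+N≡ ⟩
    (x + e) % N + k          ∎
    where
    open ≡-Reasoning
    k≤x : k ≤ x
    k≤x = ≮⇒≥ x≮k
    s : ∀ a e k → a + (e + k) ≡ (a + k) + e
    s = solve-∀
    x-k+N≡ : (x ∸ k) + N ≡ x + e
    x-k+N≡ = trans (cong ((x ∸ k) +_) (sym e+k≡N)) (trans (s (x ∸ k) e k) (cong (_+ e) (m∸n+n≡m k≤x)))

  record HasPhase (U : Subset N) (c : ℕ) : Set where
    constructor hasPhase
    field lookup-phase : ∀ i → lookup U i ≡ does (phase c i <? k)

  open HasPhase public

  phaseSet : ℕ → Subset N
  phaseSet c = tabulate (λ i → does (phase c i <? k))

  phaseSet-hasPhase : ∀ c → HasPhase (phaseSet c) c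
  phaseSet-hasPhase c = hasPhase (lookup∘tabulate (λ i → does (phase c i <? k)))

  hasPhase-unique : ∀ {U V c} → HasPhase U c → HasPhase V c → U ≡ V
  hasPhase-unique {U} {V} U≡ V≡ = begin
    U                        ≡⟨ tabulate∘lookup U ⟨
    tabulate (lookup U)      ≡⟨ tabulate-cong (λ i → trans (lookup-phase U≡ i) (sym (lookup-phase V≡ i))) ⟩
    tabulate (lookup V)      ≡⟨ tabulate∘lookup V ⟩
    V                        ∎
    where open ≡-Reasoning

  module _ {U : Subset N} {c : ℕ} (U≡ : HasPhase U c) where

    phase<k⇒∈ : ∀ {i} → phase c i < k → i ∈ U
    phase<k⇒∈ {i} p = lookup⇒[]= i U (trans (lookup-phase U≡ i) (dec-true (phase c i <? k) p))

    ∈⇒phase<k : ∀ {i} → i ∈ U → phase c i < k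
    ∈⇒phase<k {i} i∈U with phase c i <? k
    ... | yes p = p
    ... | no ¬p with () ← trans (sym ([]=⇒lookup i∈U)) (trans (lookup-phase U≡ i) (dec-false (phase c i <? k) ¬p))

    arcCount-phase : ∀ m i → arcCount U i m * N + phase c i ≡ phase c (shift m i) + m * k
    arcCount-phase zero    i = sym (+-identityʳ (phase c i))
    arcCount-phase (suc m) i = begin
      arcCount U i (suc m) * N + phase c i           ≡⟨ cong (λ x → x * N + phase c i) (arcCount-suc U i m) ⟩
      (b + A) * N + phase c i                        ≡⟨ s₁ b A N (phase c i) ⟩
      (b * N + phase c i) + A * N                    ≡⟨ cong (_+ A * N) one-step ⟩
      (phase c (csuc i) + k) + A * N                 ≡⟨ s₂ (phase c (csuc i)) k (A * N) ⟩
      k + (A * N + phase c (csuc i))                 ≡⟨ cong (k +_) (arcCount-phase m (csuc i)) ⟩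
      k + (phase c (shift m (csuc i)) + m * k)       ≡⟨ s₃ k (phase c (shift m (csuc i))) m ⟩
      phase c (shift m (csuc i)) + suc m * k         ∎
      where
      open ≡-Reasoning
      b = bit (lookup U i)
      A = arcCount U (csuc i) m
      one-step : b * N + phase c i ≡ phase c (csuc i) + k
      one-step = trans (cong (λ x → bit x * N + phase c i) (lookup-phase U≡ i))
                   (trans (phase-step (phase c i) (phase<N c i)) (cong (_+ k) (sym (phase-csuc c i))))
      s₁ : ∀ b a N r → (b + a) * N + r ≡ (b * N + r) + a * N
      s₁ = solve-∀
      s₂ : ∀ r k x → (r + k) + x ≡ k + (x + r)
      s₂ = solve-∀
      s₃ : ∀ k r m → k + (r + m * k) ≡ r + (1 + m) * k
      s₃ = solve-∀

    hasPhase⇒size : ∣ U ∣ ≡ k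
    hasPhase⇒size = trans (sym (arcCount-N U fzero)) (*-cancelʳ-≡ _ _ N (+-cancelʳ-≡ (phase c fzero) _ _ (begin
      arcCount U fzero N * N + phase c fzero    ≡⟨ arcCount-phase N fzero ⟩
      phase c (shift N fzero) + N * k           ≡⟨ cong (λ j → phase c j + N * k) (shift-N fzero) ⟩
      phase c fzero + N * k                     ≡⟨ +-comm (phase c fzero) (N * k) ⟩
      N * k + phase c fzero                     ≡⟨ cong (_+ phase c fzero) (*-comm N k) ⟩
      k * N + phase c fzero                     ∎)))
      where open ≡-Reasoning

    hasPhase⇒wellSpread : WellSpread U
    hasPhase⇒wellSpread m _ _ a b = m≤1+n⇒∣m-n∣≤1 _ _ (bound a b) (bound b a)
      where
      bound : ∀ a b → arcCount U a m ≤ suc (arcCount U b m)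
      bound a b = quotient-≤-suc N (arcCount U a m) (arcCount U b m) (phase c a) (phase c (shift m a))
                    (phase c b) (phase c (shift m b)) (m * k)
                    (arcCount-phase m a) (arcCount-phase m b) (phase<N c (shift m a)) (phase<N c b)

    hasPhase⇒stable : k ≤ e → Stable U
    hasPhase⇒stable k≤e i i∈U csuc-i∈U = <-irrefl refl (begin-strict
      k                          ≤⟨ k≤e ⟩
      e                          ≤⟨ m≤n+m e (phase c i) ⟩
      phase c i + e              ≡⟨ m<n⇒m%n≡m no-wrap ⟨
      (phase c i + e) % N        ≡⟨ phase-csuc c i ⟨
      phase c (csuc i)           <⟨ ∈⇒phase<k csuc-i∈U ⟩
      k                          ∎)
      where
      open ≤-Reasoning
      no-wrap : phase c i + e < N
      no-wrap = subst (phase c i + e <_) (trans (+-comm k e) e+k≡N) (+-monoˡ-< e (∈⇒phase<k i∈U))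

    hasPhase⇒QVertex : k ≤ e → QVertex N k U
    hasPhase⇒QVertex k≤e = hasPhase⇒size , hasPhase⇒stable k≤e , hasPhase⇒wellSpread

  module Characterisation {U : Subset N} (U-vertex : QVertex N k U) where

    U-size : ∣ U ∣ ≡ k
    U-size = proj₁ U-vertex

    U-wellSpread : WellSpread U
    U-wellSpread = proj₂ (proj₂ U-vertex)

    arcCount-N* : ∀ m i → arcCount U i (N * m) ≡ m * k
    arcCount-N* m i = trans (cong (arcCount U i) (*-comm N m)) (trans (arcCount-*N U m i) (cong (m *_) U-size))

    blocks-lower : ∀ m L → (∀ j → L ≤ suc (arcCount U j m)) → ∀ t i → t * L ≤ arcCount U i (t * m) + t
    blocks-lower m L L≤ zero    i = z≤n
    blocks-lower m L L≤ (suc t) i = subst (suc t * L ≤_) regroup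
      (+-mono-≤ (L≤ i) (blocks-lower m L L≤ t (shift m i)))
      where
      s : ∀ a x t → suc a + (x + t) ≡ (a + x) + suc t
      s = solve-∀
      regroup : suc (arcCount U i m) + (arcCount U (shift m i) (t * m) + t) ≡ arcCount U i (suc t * m) + suc t
      regroup = trans (s (arcCount U i m) (arcCount U (shift m i) (t * m)) t)
                      (cong (_+ suc t) (sym (arcCount-+ U m (t * m) i)))

    -- The N rotations of an arc of length m cover the cycle m times, and by well-spreadness
    -- none of them holds fewer than A - 1 elements.
    arcCount-upper : ∀ i m → 1 ≤ m → suc m ≤ N → arcCount U i m * N < m * k + N
    arcCount-upper i m 1≤m 1+m≤N = ≰⇒> λ too-big → <-irrefl refl (begin-strict
      m * k + N                    ≤⟨ too-big ⟩
      A * N                        ≡⟨ s₁ A n' ⟩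
      A + n' * A                   ≤⟨ +-monoʳ-≤ A (blocks-lower m A A≤ n' (shift m i)) ⟩
      A + (X + n')                 ≡⟨ +-assoc A X n' ⟨
      (A + X) + n'                 ≡⟨ cong (_+ n') (arcCount-+ U m (n' * m) i) ⟨
      arcCount U i (N * m) + n'    ≡⟨ cong (_+ n') (arcCount-N* m i) ⟩
      m * k + n'                   <⟨ +-monoʳ-< (m * k) (n<1+n n') ⟩
      m * k + N                    ∎)
      where
      open ≤-Reasoning
      A = arcCount U i m
      X = arcCount U (shift m i) (n' * m)
      A≤ : ∀ j → A ≤ suc (arcCount U j m)
      A≤ j = ∣m-n∣≤1⇒m≤1+n A (arcCount U j m) (U-wellSpread m 1≤m 1+m≤N i j)
      s₁ : ∀ a n → a * suc n ≡ a + n * a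
      s₁ = solve-∀

    -- F j = G j + N * k for G j = h j * N - j * k, which is N-periodic; the shift avoids integers.
    h : ℕ → ℕ
    h j = arcCount U fzero j

    F : ℕ → ℕ
    F j = h j * N + (N ∸ j) * k

    F+jk : ∀ j → j ≤ N → F j + j * k ≡ h j * N + N * k
    F+jk j j≤N = trans (+-assoc (h j * N) _ _) (cong (h j * N +_)
      (trans (sym (*-distribʳ-+ k (N ∸ j) j)) (cong (_* k) (m∸n+n≡m j≤N))))

    h-N+ : ∀ j → h (N + j) ≡ k + h j
    h-N+ j = trans (arcCount-+ U N j fzero)
      (cong₂ _+_ (trans (arcCount-N U fzero) U-size) (cong (λ i → arcCount U i j) (shift-N fzero)))

    j₀ : ℕ
    j₀ = proj₁ (argmin F n')

    j₀<N : j₀ < N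
    j₀<N = proj₁ (proj₂ (argmin F n'))

    i₀ : Fin N
    i₀ = shift j₀ fzero

    toℕ-i₀ : toℕ i₀ ≡ j₀
    toℕ-i₀ = trans (toℕ-shift j₀ fzero) (m<n⇒m%n≡m j₀<N)

    h-minimal : ∀ j → j < N → h j₀ * N + j * k ≤ h j * N + j₀ * k
    h-minimal j j<N = +-cancelʳ-≤ (N * k) _ _ (begin
      h j₀ * N + j * k + N * k        ≡⟨ s₁ (h j₀ * N) (j * k) (N * k) ⟩
      (h j₀ * N + N * k) + j * k      ≡⟨ cong (_+ j * k) (F+jk j₀ (<⇒≤ j₀<N)) ⟨
      (F j₀ + j₀ * k) + j * k         ≡⟨ s₂ (F j₀) (j₀ * k) (j * k) ⟩
      F j₀ + (j * k + j₀ * k)         ≤⟨ +-monoˡ-≤ (j * k + j₀ * k) (proj₂ (proj₂ (argmin F n')) j j<N) ⟩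
      F j + (j * k + j₀ * k)          ≡⟨ s₃ (F j) (j * k) (j₀ * k) ⟩
      (F j + j * k) + j₀ * k          ≡⟨ cong (_+ j₀ * k) (F+jk j (<⇒≤ j<N)) ⟩
      (h j * N + N * k) + j₀ * k      ≡⟨ s₁ (h j * N) (N * k) (j₀ * k) ⟩
      h j * N + j₀ * k + N * k        ∎)
      where
      open ≤-Reasoning
      s₁ : ∀ x y z → x + y + z ≡ x + z + y
      s₁ = solve-∀
      s₂ : ∀ x y z → (x + y) + z ≡ x + (z + y)
      s₂ = solve-∀
      s₃ : ∀ x y z → x + (y + z) ≡ (x + y) + z
      s₃ = solve-∀

    A : ℕ → ℕ
    A m = arcCount U i₀ m

    h-j₀+ : ∀ m → h (j₀ + m) ≡ h j₀ + A m
    h-j₀+ m = arcCount-+ U j₀ m fzero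

    arcCount-lower : ∀ m → m < N → m * k ≤ A m * N
    arcCount-lower m m<N with j₀ + m <? N
    ... | yes j₀+m<N = +-cancelˡ-≤ (h j₀ * N + j₀ * k) _ _ (begin
      h j₀ * N + j₀ * k + m * k        ≡⟨ s₁ (h j₀) N j₀ k m ⟩
      h j₀ * N + (j₀ + m) * k          ≤⟨ h-minimal (j₀ + m) j₀+m<N ⟩
      h (j₀ + m) * N + j₀ * k          ≡⟨ cong (λ z → z * N + j₀ * k) (h-j₀+ m) ⟩
      (h j₀ + A m) * N + j₀ * k        ≡⟨ s₂ (h j₀) (A m) N j₀ k ⟩
      h j₀ * N + j₀ * k + A m * N      ∎)
      where
      open ≤-Reasoning
      s₁ : ∀ a N j k m → a * N + j * k + m * k ≡ a * N + (j + m) * k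
      s₁ = solve-∀
      s₂ : ∀ a c N j k → (a + c) * N + j * k ≡ a * N + j * k + c * N
      s₂ = solve-∀
    ... | no j₀+m≮N = +-cancelˡ-≤ (N * k + (h j₀ * N + j₀ * k)) _ _ (begin
      N * k + (h j₀ * N + j₀ * k) + m * k             ≡⟨ s₁ N k (h j₀) j₀ m ⟩
      N * k + h j₀ * N + (j₀ + m) * k                 ≡⟨ cong (λ z → N * k + h j₀ * N + z * k) j₀+m≡ ⟩
      N * k + h j₀ * N + (N + j) * k                  ≡⟨ s₂ N k (h j₀) j ⟩
      (h j₀ * N + j * k) + (N * k + N * k)            ≤⟨ +-monoˡ-≤ (N * k + N * k) (h-minimal j j<N) ⟩
      (h j * N + j₀ * k) + (N * k + N * k)            ≡⟨ s₃ (h j) N j₀ k ⟩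
      N * k + (k + h j) * N + j₀ * k                  ≡⟨ cong (λ z → N * k + z * N + j₀ * k) h-wrap ⟩
      N * k + (h j₀ + A m) * N + j₀ * k               ≡⟨ s₄ N k (h j₀) (A m) j₀ ⟩
      N * k + (h j₀ * N + j₀ * k) + A m * N           ∎)
      where
      open ≤-Reasoning
      j = (j₀ + m) ∸ N
      j₀+m≡ : j₀ + m ≡ N + j
      j₀+m≡ = sym (m+[n∸m]≡n (≮⇒≥ j₀+m≮N))
      j<N : j < N
      j<N = +-cancelˡ-< N j N (subst (_< N + N) j₀+m≡ (+-mono-< j₀<N m<N))
      h-wrap : k + h j ≡ h j₀ + A m
      h-wrap = trans (sym (h-N+ j)) (trans (cong h (sym j₀+m≡)) (h-j₀+ m))
      s₁ : ∀ N k a j m → N * k + (a * N + j * k) + m * k ≡ N * k + a * N + (j + m) * k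
      s₁ = solve-∀
      s₂ : ∀ N k a j → N * k + a * N + (N + j) * k ≡ (a * N + j * k) + (N * k + N * k)
      s₂ = solve-∀
      s₃ : ∀ d N j k → (d * N + j * k) + (N * k + N * k) ≡ N * k + (k + d) * N + j * k
      s₃ = solve-∀
      s₄ : ∀ N k a c j → N * k + (a + c) * N + j * k ≡ N * k + (a * N + j * k) + c * N
      s₄ = solve-∀

    arcCount-bounds : ∀ m → m ≤ N → m * k ≤ A m * N × A m * N < m * k + N
    arcCount-bounds zero    _     = z≤n , s≤s z≤n
    arcCount-bounds (suc m) 1+m≤N with m≤n⇒m<n∨m≡n 1+m≤N
    ... | inj₁ 1+m<N = arcCount-lower (suc m) 1+m<N , arcCount-upper i₀ (suc m) (s≤s z≤n) 1+m<N
    ... | inj₂ 1+m≡N = ≤-reflexive full , subst (_< suc m * k + N) full (m<m+n (suc m * k) (s≤s z≤n))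
      where
      full : suc m * k ≡ A (suc m) * N
      full = begin
        suc m * k          ≡⟨ cong (_* k) 1+m≡N ⟩
        N * k              ≡⟨ *-comm N k ⟩
        k * N              ≡⟨ cong (_* N) (trans (arcCount-N U i₀) U-size) ⟨
        A N * N            ≡⟨ cong (λ z → A z * N) 1+m≡N ⟨
        A (suc m) * N      ∎
        where open ≡-Reasoning

    c₀ : ℕ
    c₀ = (j₀ * k) % N

    c₀<N : c₀ < N
    c₀<N = m%n<n (j₀ * k) N

    -- The remainder r = A m N - m k ∈ [0,N) is the phase of the point m steps after i₀.
    module AtDistance (m : ℕ) (m<N : m < N) where

      x : Fin N
      x = shift m i₀

      r : ℕ
      r = proj₁ (m≤n⇒∃[o]m+o≡n (proj₁ (arcCount-bounds m (<⇒≤ m<N))))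

      mk+r≡ : m * k + r ≡ A m * N
      mk+r≡ = proj₂ (m≤n⇒∃[o]m+o≡n (proj₁ (arcCount-bounds m (<⇒≤ m<N))))

      r<N : r < N
      r<N = +-cancelˡ-< (m * k) r N (subst (_< m * k + N) (sym mk+r≡) (proj₂ (arcCount-bounds m (<⇒≤ m<N))))

      A-suc : A (suc m) ≡ A m + bit (lookup U x)
      A-suc = trans (cong A (+-comm 1 m)) (trans (arcCount-+ U m 1 i₀) (cong (A m +_) (arcCount-1 U x)))

      lookup-by-remainder : lookup U x ≡ does (r <? k)
      lookup-by-remainder with lookup U x in lookup≡
      ... | true = sym (dec-true (r <? k) (+-cancelˡ-< (m * k) r k (+-cancelʳ-< N (m * k + r) (m * k + k)
                     (subst₂ _<_ next≡ (s₂ m k) (proj₂ (arcCount-bounds (suc m) m<N))))))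
        where
        s₁ : ∀ a N → (a + 1) * N ≡ a * N + N
        s₁ = solve-∀
        s₂ : ∀ m k → suc m * k + N ≡ m * k + k + N
        s₂ = solve-∀
        next≡ : A (suc m) * N ≡ m * k + r + N
        next≡ = trans (cong (_* N) (trans A-suc (cong (λ b → A m + bit b) lookup≡)))
                      (trans (s₁ (A m) N) (cong (_+ N) (sym mk+r≡)))
      ... | false = sym (dec-false (r <? k) (λ r<k → <⇒≱ r<k (+-cancelˡ-≤ (m * k) k r
                      (subst₂ _≤_ (s m k) next≡ (proj₁ (arcCount-bounds (suc m) m<N))))))
        where
        s : ∀ m k → suc m * k ≡ m * k + k
        s = solve-∀
        next≡ : A (suc m) * N ≡ m * k + r
        next≡ = trans (cong (_* N) (trans A-suc (trans (cong (λ b → A m + bit b) lookup≡) (+-identityʳ (A m)))))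
                      (sym mk+r≡)

      phase-by-remainder : phase c₀ x ≡ r
      phase-by-remainder = trans (≋-by-multiples (c₀ + t * e) r (p + q * e + A m) (j₀ + m) linear) (m<n⇒m%n≡m r<N)
        where
        open ≡-Reasoning
        t = toℕ x
        p = (j₀ * k) / N
        q = (j₀ + m) / N
        j₀+m≡ : j₀ + m ≡ t + q * N
        j₀+m≡ = trans (m≡m%n+[m/n]*n (j₀ + m) N)
                      (cong (_+ q * N) (sym (trans (toℕ-shift m i₀) (cong (λ z → (z + m) % N) toℕ-i₀))))
        s₁ : ∀ c t e p q a N → c + t * e + (p + q * e + a) * N ≡ (c + p * N) + (t + q * N) * e + a * N
        s₁ = solve-∀
        s₂ : ∀ j k m e r → j * k + (j + m) * e + (m * k + r) ≡ j * (e + k) + m * (e + k) + r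
        s₂ = solve-∀
        s₃ : ∀ j m N r → j * N + m * N + r ≡ r + (j + m) * N
        s₃ = solve-∀
        linear : c₀ + t * e + (p + q * e + A m) * N ≡ r + (j₀ + m) * N
        linear = begin
          c₀ + t * e + (p + q * e + A m) * N                ≡⟨ s₁ c₀ t e p q (A m) N ⟩
          (c₀ + p * N) + (t + q * N) * e + A m * N          ≡⟨ cong₂ (λ u v → u + v * e + A m * N)
                                                                 (sym (m≡m%n+[m/n]*n (j₀ * k) N)) (sym j₀+m≡) ⟩
          j₀ * k + (j₀ + m) * e + A m * N                   ≡⟨ cong (λ u → j₀ * k + (j₀ + m) * e + u) mk+r≡ ⟨
          j₀ * k + (j₀ + m) * e + (m * k + r)               ≡⟨ s₂ j₀ k m e r ⟩
          j₀ * (e + k) + m * (e + k) + r                    ≡⟨ cong (λ u → j₀ * u + m * u + r) e+k≡N ⟩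
          j₀ * N + m * N + r                                ≡⟨ s₃ j₀ m N r ⟩
          r + (j₀ + m) * N                                  ∎

      lookup-by-phase : lookup U x ≡ does (phase c₀ x <? k)
      lookup-by-phase = trans lookup-by-remainder (cong (λ z → does (z <? k)) (sym phase-by-remainder))

    lookup-by-phase : ∀ i → lookup U i ≡ does (phase c₀ i <? k)
    lookup-by-phase i = subst (λ z → lookup U z ≡ does (phase c₀ z <? k)) shift-m-i₀≡i
                                (AtDistance.lookup-by-phase m (m%n<n (t + (N ∸ j₀)) N))
      where
      t = toℕ i
      m = (t + (N ∸ j₀)) % N
      q = (t + (N ∸ j₀)) / N
      s : ∀ a b c → a + (b + c) ≡ b + (c + a)
      s = solve-∀
      j₀+m≡ : j₀ + m + q * N ≡ t + 1 * N
      j₀+m≡ = begin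
        j₀ + m + q * N              ≡⟨ +-assoc j₀ m (q * N) ⟩
        j₀ + (m + q * N)            ≡⟨ cong (j₀ +_) (m≡m%n+[m/n]*n (t + (N ∸ j₀)) N) ⟨
        j₀ + (t + (N ∸ j₀))         ≡⟨ s j₀ t (N ∸ j₀) ⟩
        t + ((N ∸ j₀) + j₀)         ≡⟨ cong (t +_) (m∸n+n≡m (<⇒≤ j₀<N)) ⟩
        t + N                       ≡⟨ cong (t +_) (+-identityʳ N) ⟨
        t + 1 * N                   ∎
        where open ≡-Reasoning
      shift-m-i₀≡i : shift m i₀ ≡ i
      shift-m-i₀≡i = toℕ-injective (trans (toℕ-shift m i₀) (trans (cong (λ z → (z + m) % N) toℕ-i₀)
                       (trans (≋-by-multiples (j₀ + m) t q 1 j₀+m≡) (m<n⇒m%n≡m (toℕ<n i)))))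

    QVertex⇒hasPhase : HasPhase U c₀
    QVertex⇒hasPhase = hasPhase lookup-by-phase

  Meet : ℕ → ℕ → Set
  Meet a b = ∃ λ y → (a + y) % N < k × (b + y) % N < k

  meet-refl : 1 ≤ k → ∀ a → a ≤ N → Meet a a
  meet-refl 1≤k a a≤N = N ∸ a , in-arc , in-arc
    where
    in-arc : (a + (N ∸ a)) % N < k
    in-arc = subst (_< k) (sym (trans (cong (_% N) (m+[n∸m]≡n a≤N)) (n%n≡0 N))) 1≤k

  hasPhase-meet : ∀ {U V a b i} → HasPhase U a → HasPhase V b → i ∈ U → i ∈ V → Meet a b
  hasPhase-meet {i = i} U≡ V≡ i∈U i∈V = toℕ i * e , ∈⇒phase<k U≡ i∈U , ∈⇒phase<k V≡ i∈V

  gap-shift : ∀ a b y → a < N → ((a + y) % N + gap a b) ≋ ((b + y) % N)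
  gap-shift a b y a<N = begin
    ((a + y) % N + gap a b) % N       ≡⟨ +-≋ ((a + y) % N) (a + y) (gap a b) (b + (N ∸ a)) (%-≋ (a + y)) (%-≋ (b + (N ∸ a))) ⟩
    ((a + y) + (b + (N ∸ a))) % N     ≡⟨ ≡⇒≋ (s a y b (N ∸ a)) ⟩
    ((b + y) + (a + (N ∸ a))) % N     ≡⟨ ≡⇒≋ (cong ((b + y) +_) (m+[n∸m]≡n (<⇒≤ a<N))) ⟩
    ((b + y) + N) % N                 ≡⟨ +N-≋ (b + y) ⟩
    (b + y) % N                       ≡⟨ %-≋ (b + y) ⟨
    (b + y) % N % N                   ∎
    where
    open ≡-Reasoning
    s : ∀ a y b c → (a + y) + (b + c) ≡ (b + y) + (a + c)
    s = solve-∀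

  meet⇒gap-near-0 : ∀ a b → a < N → b < N → Meet a b → gap a b < k ⊎ N < gap a b + k
  meet⇒gap-near-0 a b a<N b<N (y , za<k , zb<k) with (a + y) % N ≤? (b + y) % N
  ... | yes za≤zb = inj₁ (subst (_< k) (sym gap≡) (≤-<-trans (m∸n≤m zb za) zb<k))
    where
    za = (a + y) % N
    zb = (b + y) % N
    gap≡ : gap a b ≡ zb ∸ za
    gap≡ = ≋⇒≡ (≋-cancelʳ (gap a b) (zb ∸ za) za
             (trans (≡⇒≋ (+-comm (gap a b) za))
               (trans (gap-shift a b y a<N) (≡⇒≋ (trans (sym (m+[n∸m]≡n za≤zb)) (+-comm za (zb ∸ za)))))))
             (gap<N a b) (≤-<-trans (m∸n≤m zb za) (m%n<n (b + y) N))
  ... | no za≰zb = inj₂ (subst (λ z → N < z + k) (sym gap≡) (+-cancelˡ-< za N (x + k) (begin-strict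
      za + N              ≤⟨ +-monoʳ-≤ za (m≤n+m N zb) ⟩
      za + (zb + N)       ≡⟨ cong (za +_) za+x≡ ⟨
      za + (za + x)       <⟨ +-monoʳ-< za (subst (_< x + k) (+-comm x za) (+-monoʳ-< x za<k)) ⟩
      za + (x + k)        ∎)))
    where
    open ≤-Reasoning
    za = (a + y) % N
    zb = (b + y) % N
    x = (zb + N) ∸ za
    za+x≡ : za + x ≡ zb + N
    za+x≡ = m+[n∸m]≡n (≤-trans (<⇒≤ (m%n<n (a + y) N)) (m≤n+m N zb))
    x<N : x < N
    x<N = +-cancelˡ-< za x N (subst (_< za + N) (sym za+x≡) (+-monoˡ-< N (≰⇒> za≰zb)))
    gap≡ : gap a b ≡ x
    gap≡ = ≋⇒≡ (≋-cancelʳ (gap a b) x za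
             (trans (≡⇒≋ (+-comm (gap a b) za))
               (trans (gap-shift a b y a<N) (trans (sym (+N-≋ zb)) (≡⇒≋ (trans (sym za+x≡) (+-comm za x)))))))
             (gap<N a b) x<N

  meet⇒¬gap-far : ∀ a b → a < N → b < N → Meet a b → k ≤ gap a b → gap a b + k ≤ N → ⊥
  meet⇒¬gap-far a b a<N b<N meet k≤gap gap+k≤N with meet⇒gap-near-0 a b a<N b<N meet
  ... | inj₁ gap<k   = <⇒≱ gap<k k≤gap
  ... | inj₂ N<gap+k = <⇒≱ N<gap+k gap+k≤N

  module Coprime (coprime : gcd N k ≡ 1) where

    e-invertible : ∃ λ u → (u * e) ≋ 1
    e-invertible with subst (λ d → Bézout.Identity d N k) coprime (Bézout.identity (gcd-GCD N k))
    ... | Bézout.Identity.+- x y 1+yk≡xN = y , ≋-by-multiples (y * e) 1 x y (begin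
      y * e + x * N          ≡⟨ cong (y * e +_) 1+yk≡xN ⟨
      y * e + (1 + y * k)    ≡⟨ s y e k ⟩
      1 + y * (e + k)        ≡⟨ cong (λ z → 1 + y * z) e+k≡N ⟩
      1 + y * N              ∎)
      where
      open ≡-Reasoning
      s : ∀ y e k → y * e + (1 + y * k) ≡ 1 + y * (e + k)
      s = solve-∀
    ... | Bézout.Identity.-+ x y 1+xN≡yk = y * n' , ≋-by-multiples (y * n' * e) 1 (1 + n' * x) (y * n') (begin
      y * n' * e + (1 + n' * x) * N             ≡⟨ s₁ y n' e x ⟩
      y * n' * e + n' * (1 + x * N) + 1         ≡⟨ cong (λ z → y * n' * e + n' * z + 1) 1+xN≡yk ⟩
      y * n' * e + n' * (y * k) + 1             ≡⟨ s₂ y n' e k ⟩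
      1 + y * n' * (e + k)                      ≡⟨ cong (λ z → 1 + y * n' * z) e+k≡N ⟩
      1 + y * n' * N                            ∎)
      where
      open ≡-Reasoning
      s₁ : ∀ y n e x → y * n * e + (1 + n * x) * suc n ≡ y * n * e + n * (1 + x * suc n) + 1
      s₁ = solve-∀
      s₂ : ∀ y n e k → y * n * e + n * (y * k) + 1 ≡ 1 + y * n * (e + k)
      s₂ = solve-∀

    phase-surjective : ∀ z → ∃ λ i → ∀ c → phase c i ≡ (c + z) % N
    phase-surjective z = i , λ c → begin
      (c + toℕ i * e) % N                ≡⟨ +-≋ c c _ (z * (u * e)) refl (trans (cong (λ t → (t * e) % N) toℕ-i) zue) ⟩
      (c + z * (u * e)) % N              ≡⟨ +-≋ c c _ z refl z[ue]≋z ⟩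
      (c + z) % N                        ∎
      where
      open ≡-Reasoning
      u = proj₁ e-invertible
      i : Fin N
      i = fromℕ< (m%n<n (z * u) N)
      toℕ-i : toℕ i ≡ (z * u) % N
      toℕ-i = toℕ-fromℕ< (m%n<n (z * u) N)
      zue : ((z * u) % N * e) ≋ (z * (u * e))
      zue = ≋-by-multiples _ _ ((z * u) / N * e) 0 (trans (s ((z * u) % N) ((z * u) / N) N e)
              (trans (cong (_* e) (sym (m≡m%n+[m/n]*n (z * u) N))) (trans (*-assoc z u e) (sym (+-identityʳ _)))))
        where
        s : ∀ r q N e → r * e + q * e * N ≡ (r + q * N) * e
        s = solve-∀
      z[ue]≋z : (z * (u * e)) ≋ z
      z[ue]≋z = begin
        (z * (u * e)) % N                  ≡⟨ %-distribˡ-* z (u * e) N ⟩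
        ((z % N) * ((u * e) % N)) % N      ≡⟨ cong (λ t → ((z % N) * t) % N) (proj₂ e-invertible) ⟩
        ((z % N) * (1 % N)) % N            ≡⟨ %-distribˡ-* z 1 N ⟨
        (z * 1) % N                        ≡⟨ cong (_% N) (*-identityʳ z) ⟩
        z % N                              ∎

  -- Katona's circle argument. Viewed from a₀ = cs 0, every cs j lies within distance k of a₀, on the
  -- near side (d j < k) or the far side (N < d j + k); folding both sides onto [0,k) is injective.
  module Circle (1≤k : 1 ≤ k) (2k≤N : k + k ≤ N) {L : ℕ} (cs : Fin (suc L) → ℕ) (cs<N : ∀ j → cs j < N)
                (cs-injective : Injective _≡_ _≡_ cs) (meets : ∀ j j' → Meet (cs j) (cs j')) where

    a₀ : ℕ
    a₀ = cs fzero

    a₀≤N : a₀ ≤ N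
    a₀≤N = <⇒≤ (cs<N fzero)

    d : Fin (suc L) → ℕ
    d j = gap a₀ (cs j)

    d-far : ∀ j → ¬ d j < k → N < d j + k
    d-far j d≮k with meet⇒gap-near-0 a₀ (cs j) (cs<N fzero) (cs<N j) (meets fzero j)
    ... | inj₁ d<k   = ⊥-elim (d≮k d<k)
    ... | inj₂ N<d+k = N<d+k

    d-injective : Injective _≡_ _≡_ d
    d-injective {j} {j'} eq = cs-injective (gap-injective a₀ (cs j) (cs j') a₀≤N (cs<N j) (cs<N j') eq)

    ¬far-offsets : ∀ j j' x → k ≤ x → x + k ≤ N → d j + x ≡ d j' → ⊥
    ¬far-offsets j j' x k≤x x+k≤N d+x≡d' = meet⇒¬gap-far (cs j) (cs j') (cs<N j) (cs<N j') (meets j j')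
      (subst (k ≤_) (sym gap≡x) k≤x) (subst (λ z → z + k ≤ N) (sym gap≡x) x+k≤N)
      where
      gap≡x : gap (cs j) (cs j') ≡ x
      gap≡x = gap-from-sum a₀ (cs j) (cs j') x a₀≤N (cs<N j) (cs<N j') (<-≤-trans (m<m+n x 1≤k) x+k≤N) (≡⇒≋ d+x≡d')

    fold : ℕ → ℕ
    fold x = if does (x <? k) then x else x + k ∸ N

    fold-near : ∀ {x} → x < k → fold x ≡ x
    fold-near {x} x<k rewrite dec-true (x <? k) x<k = refl

    fold-far : ∀ {x} → ¬ x < k → N < x + k → fold x + N ≡ x + k
    fold-far {x} x≮k N<x+k rewrite dec-false (x <? k) x≮k = m∸n+n≡m (<⇒≤ N<x+k)

    fold-d<k : ∀ j → fold (d j) < k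
    fold-d<k j with d j <? k
    ... | yes d<k = subst (_< k) (sym (fold-near d<k)) d<k
    ... | no  d≮k = +-cancelʳ-< N (fold (d j)) k (subst₂ _<_ (sym (fold-far d≮k (d-far j d≮k))) (+-comm N k)
                      (+-monoˡ-< k (gap<N a₀ (cs j))))

    slot : Fin (suc L) → Fin k
    slot j = fromℕ< (fold-d<k j)

    slot-near : ∀ {j} → d j < k → toℕ (slot j) ≡ d j
    slot-near {j} d<k = trans (toℕ-fromℕ< (fold-d<k j)) (fold-near d<k)

    slot-far : ∀ {j} → ¬ d j < k → toℕ (slot j) + N ≡ d j + k
    slot-far {j} d≮k = trans (cong (_+ N) (toℕ-fromℕ< (fold-d<k j))) (fold-far d≮k (d-far j d≮k))

    -- A near and a far element on the same slot are N - k ≥ k apart.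
    ¬near-far-same-slot : ∀ j j' → d j < k → ¬ d j' < k → toℕ (slot j) ≡ toℕ (slot j') → ⊥
    ¬near-far-same-slot j j' d<k d'≮k same = ¬far-offsets j j' (N ∸ k)
      (+-cancelʳ-≤ k k (N ∸ k) (subst (k + k ≤_) (sym N-k+k≡N) 2k≤N)) (≤-reflexive N-k+k≡N)
      (+-cancelʳ-≡ k _ _ (begin
        d j + (N ∸ k) + k       ≡⟨ +-assoc (d j) (N ∸ k) k ⟩
        d j + ((N ∸ k) + k)     ≡⟨ cong (d j +_) N-k+k≡N ⟩
        d j + N                 ≡⟨ cong (_+ N) (trans (sym (slot-near d<k)) same) ⟩
        toℕ (slot j') + N       ≡⟨ slot-far d'≮k ⟩
        d j' + k                ∎))
      where
      open ≡-Reasoning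
      N-k+k≡N : (N ∸ k) + k ≡ N
      N-k+k≡N = m∸n+n≡m k≤N

    slot-injective : Injective _≡_ _≡_ slot
    slot-injective {j} {j'} eq with d j <? k | d j' <? k
    ... | yes d<k | yes d'<k = d-injective (trans (sym (slot-near d<k)) (trans (cong toℕ eq) (slot-near d'<k)))
    ... | no  d≮k | no  d'≮k = d-injective (+-cancelʳ-≡ k _ _
                                 (trans (sym (slot-far d≮k)) (trans (cong (λ s → toℕ s + N) eq) (slot-far d'≮k))))
    ... | yes d<k | no  d'≮k = ⊥-elim (¬near-far-same-slot j j' d<k d'≮k (cong toℕ eq))
    ... | no  d≮k | yes d'<k = ⊥-elim (¬near-far-same-slot j' j d'<k d≮k (cong toℕ (sym eq)))

    toℕ-slot-injective : ∀ {j j'} → toℕ (slot j) ≡ toℕ (slot j') → j ≡ j'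
    toℕ-slot-injective {j} {j'} eq = slot-injective (toℕ-injective {i = slot j} {slot j'} eq)

    size-≤ : suc L ≤ k
    size-≤ = injective⇒≤ slot-injective

    -- With k members every slot is taken; when N > 2k the far slots form a final segment [J,k),
    -- and rotating by k - J - a₀ brings everybody into [0,k).
    module Full (L+1≡k : suc L ≡ k) (narrow : k ≡ 1 ⊎ suc (k + k) ≤ N) where

      owner : ∀ v → v < k → ∃ λ j → toℕ (slot j) ≡ v
      owner v v<k with injective⇒surjective slot slot-injective (≤-reflexive (sym L+1≡k)) (fromℕ< v<k)
      ... | j , slot≡ = j , trans (cong toℕ slot≡) (toℕ-fromℕ< v<k)

      Far : ℕ → Set
      Far v = ∀ j → toℕ (slot j) ≡ v → ¬ d j < k

      Far? : ∀ v → Dec (Far v)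
      Far? v = all? (λ j → (toℕ (slot j) ≟ v) →-dec ¬? (d j <? k))

      Far-suc : ∀ v → Far v → suc v < k → Far (suc v)
      Far-suc v far-v 2+v≤k j slot≡ d<k =
        [ (λ k≡1 → <⇒≱ (s≤s (s≤s z≤n)) (subst (suc (suc v) ≤_) k≡1 2+v≤k)) , wide ]′ narrow
        where
        wide : suc (k + k) ≤ N → ⊥
        wide 2k+1≤N = ¬far-offsets j jv x k≤x x+k≤N (+-cancelʳ-≡ k _ _ (begin
          d j + x + k           ≡⟨ cong (λ z → z + x + k) (trans (sym (slot-near d<k)) slot≡) ⟩
          suc v + x + k         ≡⟨ s v x k ⟩
          v + (x + suc k)       ≡⟨ cong (v +_) x+k+1≡N ⟩
          v + N                 ≡⟨ cong (_+ N) jv-slot ⟨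
          toℕ (slot jv) + N     ≡⟨ slot-far (far-v jv jv-slot) ⟩
          d jv + k              ∎))
          where
          open ≡-Reasoning
          jv : Fin (suc L)
          jv = proj₁ (owner v (<-trans (n<1+n v) 2+v≤k))
          jv-slot : toℕ (slot jv) ≡ v
          jv-slot = proj₂ (owner v (<-trans (n<1+n v) 2+v≤k))
          x : ℕ
          x = N ∸ suc k
          x+k+1≡N : x + suc k ≡ N
          x+k+1≡N = m∸n+n≡m (≤-trans (s≤s (m≤m+n k k)) 2k+1≤N)
          k≤x : k ≤ x
          k≤x = +-cancelʳ-≤ (suc k) k x (subst₂ _≤_ (sym (+-suc k k)) (sym x+k+1≡N) 2k+1≤N)
          x+k≤N : x + k ≤ N
          x+k≤N = subst (x + k ≤_) x+k+1≡N (+-monoʳ-≤ x (n≤1+n k))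
          s : ∀ v x k → suc v + x + k ≡ v + (x + suc k)
          s = solve-∀

      J : ℕ
      J = proj₁ (threshold Far Far? k Far-suc k ≤-refl)

      J≤k : J ≤ k
      J≤k = proj₁ (proj₂ (threshold Far Far? k Far-suc k ≤-refl))

      near-below-J : ∀ v → v < J → ¬ Far v
      near-below-J = proj₁ (proj₂ (proj₂ (threshold Far Far? k Far-suc k ≤-refl)))

      far-from-J : ∀ v → J ≤ v → v < k → Far v
      far-from-J = proj₂ (proj₂ (proj₂ (threshold Far Far? k Far-suc k ≤-refl)))

      w : ℕ
      w = k ∸ J

      y : ℕ
      y = w + (N ∸ a₀)

      cs+y≋d+w : ∀ j → (cs j + y) ≋ (d j + w)
      cs+y≋d+w j = begin
        (cs j + y) % N                         ≡⟨ +-≋ (cs j) (d j + a₀) y y cs≋d+a₀ refl ⟩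
        ((d j + a₀) + (w + (N ∸ a₀))) % N      ≡⟨ ≡⇒≋ (s (d j) a₀ w (N ∸ a₀)) ⟩
        ((d j + w) + (a₀ + (N ∸ a₀))) % N      ≡⟨ ≡⇒≋ (cong ((d j + w) +_) (m+[n∸m]≡n a₀≤N)) ⟩
        ((d j + w) + N) % N                    ≡⟨ +N-≋ (d j + w) ⟩
        (d j + w) % N                          ∎
        where
        open ≡-Reasoning
        s : ∀ a b c e → (a + b) + (c + e) ≡ (a + c) + (b + e)
        s = solve-∀
        cs≋d+a₀ : cs j ≋ (d j + a₀)
        cs≋d+a₀ = trans (m<n⇒m%n≡m (cs<N j)) (sym (gap+a a₀ (cs j) a₀≤N (cs<N j)))

      J+w≡k : J + w ≡ k
      J+w≡k = m+[n∸m]≡n J≤k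

      common-point-by-side : ∀ j → Dec (d j < k) → (cs j + y) % N < k
      common-point-by-side j (yes d<k) = subst (_< k) (sym (trans (cs+y≋d+w j) (m<n⇒m%n≡m (<-≤-trans d+w<k k≤N)))) d+w<k
        where
        d<J : d j < J
        d<J = decidable-stable (d j <? J) (λ d≮J → far-from-J (d j) (≮⇒≥ d≮J) d<k j (slot-near d<k) d<k)
        d+w<k : d j + w < k
        d+w<k = subst (d j + w <_) J+w≡k (+-monoˡ-< w d<J)
      common-point-by-side j (no d≮k) = subst (_< k) (sym (trans (cs+y≋d+w j) d+w≋s-J)) (≤-<-trans (m∸n≤m s J) (toℕ<n (slot j)))
        where
        s = toℕ (slot j)
        J≤s : J ≤ s
        J≤s = ≮⇒≥ (λ s<J → near-below-J s s<J (λ j' slot≡ → subst (λ z → ¬ d z < k)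
                (toℕ-slot-injective (sym slot≡)) d≮k))
        d+w≡ : d j + w ≡ (s ∸ J) + N
        d+w≡ = +-cancelʳ-≡ J _ _ (begin
          d j + w + J             ≡⟨ +-assoc (d j) w J ⟩
          d j + (w + J)           ≡⟨ cong (d j +_) (trans (+-comm w J) J+w≡k) ⟩
          d j + k                 ≡⟨ slot-far d≮k ⟨
          s + N                   ≡⟨ cong (_+ N) (m∸n+n≡m J≤s) ⟨
          (s ∸ J) + J + N         ≡⟨ swap (s ∸ J) J N ⟩
          (s ∸ J) + N + J         ∎)
          where
          open ≡-Reasoning
          swap : ∀ a b c → a + b + c ≡ a + c + b
          swap = solve-∀
        d+w≋s-J : (d j + w) % N ≡ s ∸ J
        d+w≋s-J = trans (cong (_% N) d+w≡) (trans (+N-≋ (s ∸ J))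
                    (m<n⇒m%n≡m (≤-<-trans (m∸n≤m s J) (<-≤-trans (toℕ<n (slot j)) k≤N))))

      common-point : ∀ j → (cs j + y) % N < k
      common-point j = common-point-by-side j (d j <? k)

module IndependentSets (n' k : ℕ) (1≤k : 1 ≤ k) (2k≤N : k + k ≤ suc n') (coprime : gcd (suc n') k ≡ 1) where

  k≤N : k ≤ suc n'
  k≤N = ≤-trans (m≤m+n k k) 2k≤N

  open Phases n' k k≤N
  open Coprime coprime

  k≤e : k ≤ e
  k≤e = +-cancelʳ-≤ k k e (subst (k + k ≤_) (sym e+k≡N) 2k≤N)

  -- For N = 2k the k-arcs split into disjoint antipodal pairs, but then k = gcd N k = 1.
  narrow : k ≡ 1 ⊎ suc (k + k) ≤ N
  narrow with m≤n⇒m<n∨m≡n 2k≤N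
  ... | inj₁ 2k<N = inj₂ 2k<N
  ... | inj₂ 2k≡N = inj₁ (∣1⇒≡1 (subst (k ∣_) coprime
                      (gcd-greatest (subst (k ∣_) 2k≡N (∣m∣n⇒∣m+n ∣-refl ∣-refl)) ∣-refl)))

  phaseSet-distinct : ∀ {i j} → i < j → j < k → phaseSet i ≢ phaseSet j
  phaseSet-distinct {i} {j} i<j j<k eq = <⇒≱ (∈⇒phase<k (phaseSet-hasPhase i) x∈Uᵢ) k≤phase-i
    where
    z : ℕ
    z = N ∸ j
    x : Fin N
    x = proj₁ (phase-surjective z)
    phase-x : ∀ c → phase c x ≡ (c + z) % N
    phase-x = proj₂ (phase-surjective z)
    j≤N : j ≤ N
    j≤N = <⇒≤ (<-≤-trans j<k k≤N)
    x∈Uⱼ : x ∈ phaseSet j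
    x∈Uⱼ = phase<k⇒∈ (phaseSet-hasPhase j)
             (subst (_< k) (sym (trans (phase-x j) (trans (cong (_% N) (m+[n∸m]≡n j≤N)) (n%n≡0 N)))) 1≤k)
    x∈Uᵢ : x ∈ phaseSet i
    x∈Uᵢ = subst (x ∈_) (sym eq) x∈Uⱼ
    k≤phase-i : k ≤ phase i x
    k≤phase-i = subst (k ≤_) (sym (trans (phase-x i) (m<n⇒m%n≡m (subst (i + z <_) (m+[n∸m]≡n j≤N) (+-monoˡ-< z i<j)))))
                  (≤-trans (≤-trans k≤e (∸-monoʳ-≤ N (<⇒≤ j<k))) (m≤n+m z i))

  zero∈phaseSet : ∀ c → c < k → fzero ∈ phaseSet c
  zero∈phaseSet c c<k = phase<k⇒∈ (phaseSet-hasPhase c)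
    (subst (_< k) (sym (trans (cong (_% N) (+-identityʳ c)) (m<n⇒m%n≡m (<-≤-trans c<k k≤N)))) c<k)

  star : List (Subset N)
  star = applyUpTo phaseSet k

  length-star : length star ≡ k
  length-star = length-applyUpTo phaseSet k

  star-independent : IndependentQ N k star
  star-independent = Unique.applyUpTo⁺₁ phaseSet k phaseSet-distinct
                   , All.applyUpTo⁺₂ phaseSet k (λ c → hasPhase⇒QVertex (phaseSet-hasPhase c) k≤e)
                   , AllPairs.applyUpTo⁺₁ phaseSet k (λ i<j j<k disjoint →
                       disjoint fzero (zero∈phaseSet _ (<-trans i<j j<k)) (zero∈phaseSet _ j<k))

  circle : ∀ L (cs : Fin L → ℕ) → (∀ j → cs j < N) → Injective _≡_ _≡_ cs → (∀ j j' → Meet (cs j) (cs j')) →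
           L ≤ k × (L ≡ k → ∃ λ y → ∀ j → (cs j + y) % N < k)
  circle zero    cs cs<N cs-inj meets = z≤n , λ 0≡k → ⊥-elim (<⇒≱ 1≤k (≤-reflexive (sym 0≡k)))
  circle (suc L) cs cs<N cs-inj meets = C.size-≤ , λ L+1≡k → C.Full.y L+1≡k narrow , C.Full.common-point L+1≡k narrow
    where module C = Circle 1≤k 2k≤N cs cs<N cs-inj meets

  module Independent {I : List (Subset N)} (I-independent : IndependentQ N k I) where

    member : Fin (length I) → Subset N
    member = List.lookup I

    member-vertex : ∀ j → QVertex N k (member j)
    member-vertex j = All.lookup (proj₁ (proj₂ I-independent)) (∈-lookup j)

    cs : Fin (length I) → ℕ
    cs j = Characterisation.c₀ (member-vertex j)

    cs<N : ∀ j → cs j < N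
    cs<N j = Characterisation.c₀<N (member-vertex j)

    member-hasPhase : ∀ j → HasPhase (member j) (cs j)
    member-hasPhase j = Characterisation.QVertex⇒hasPhase (member-vertex j)

    cs-injective : Injective _≡_ _≡_ cs
    cs-injective {j} {j'} eq = Unique-lookup-injective (proj₁ I-independent)
      (hasPhase-unique (member-hasPhase j) (subst (HasPhase (member j')) (sym eq) (member-hasPhase j')))

    meets : ∀ j j' → Meet (cs j) (cs j')
    meets j j' with j ≟ᶠ j'
    ... | yes refl = meet-refl 1≤k (cs j) (<⇒≤ (cs<N j))
    ... | no  j≢j' with any? (λ i → i ∈? member j ×-dec i ∈? member j')
    ...   | yes (i , i∈ , i∈′) = hasPhase-meet (member-hasPhase j) (member-hasPhase j') i∈ i∈′
    ...   | no  ¬common = ⊥-elim (AllPairs-lookup (λ ¬disj disj → ¬disj (λ i i∈ i∈′ → disj i i∈′ i∈))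
                            (proj₂ (proj₂ I-independent)) j j' j≢j' (λ i i∈ i∈′ → ¬common (i , i∈ , i∈′)))

    phases-bounds : length I ≤ k × (length I ≡ k → ∃ λ y → ∀ j → (cs j + y) % N < k)
    phases-bounds = circle (length I) cs cs<N cs-injective meets

    length≤k : length I ≤ k
    length≤k = proj₁ phases-bounds

    common-element : length I ≡ k → ∃ λ (i : Fin N) → (S : Subset N) → S ∈ₗ I → i ∈ S
    common-element |I|≡k = x , λ S S∈I → subst (x ∈_) (sym (lookup-index S∈I)) (x∈member (Any.index S∈I))
      where
      y : ℕ
      y = proj₁ (proj₂ phases-bounds |I|≡k)
      in-arc : ∀ j → (cs j + y) % N < k
      in-arc = proj₂ (proj₂ phases-bounds |I|≡k)
      x : Fin N
      x = proj₁ (phase-surjective y)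
      phase-x : ∀ c → phase c x ≡ (c + y) % N
      phase-x = proj₂ (phase-surjective y)
      x∈member : ∀ j → x ∈ member j
      x∈member j = phase<k⇒∈ (member-hasPhase j) (subst (_< k) (sym (phase-x (cs j))) (in-arc j))

corollary17 : (n k : ℕ) → 1 ≤ k → 2 * k ≤ n → gcd n k ≡ 1 →
    -- α(Q(n,k)) = k
    ((∃ λ (I : List (Subset n)) → IndependentQ n k I × length I ≡ k)
     × ((I : List (Subset n)) → IndependentQ n k I → length I ≤ k))
    -- every independent set of size k has a common element
    × ((I : List (Subset n)) → IndependentQ n k I → length I ≡ k →
         ∃ λ (i : Fin n) → (S : Subset n) → S ∈ₗ I → i ∈ S)
corollary17 zero     (suc k) 1≤k () coprime
corollary17 (suc n') k       1≤k 2k≤n coprime =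
    ((star , star-independent , length-star) , λ I I-indep → Independent.length≤k I-indep)
  , λ I I-indep → Independent.common-element I-indep
  where open IndependentSets n' k 1≤k (subst (_≤ suc n') (cong (k +_) (+-identityʳ k)) 2k≤n) coprime
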